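{- Let $\Phi$ be a linear datum and $i\in I^\Phi$, and let $s\ge1$. Then $\Phi$ has Cauchy--Schwarz complexity at most $s$ at $i$ if and only if there exists a morphism of linear data $\Theta\colon\mathrm{gc}_s(W^\Phi_i)\to\Phi$ respecting $i$ with $\alpha^\Theta(i)=\triangle$.
   Context: Fix a prime $p$. A linear datum $\Phi=(I,V,(W_i),(\phi_i))$: finite index set $I$, finite-dimensional $\mathbb{F}_p$-spaces $V,W_i$, linear maps $\phi_i\colon V\to W_i$. With a symbol $*$, $W_*=\{0\}$, $\phi_*=0$: a morphism $\Theta\colon\Phi'\to\Phi$ of shape $\alpha\colon I^\Phi\to I^{\Phi'}\cup\{*\}$ is a linear $\theta\colon V^{\Phi'}\to V^\Phi$ with linear $\sigma_j\colon W^{\Phi'}_{\alpha(j)}\to W^\Phi_j$ such that $\sigma_j\circ\phi^{\Phi'}_{\alpha(j)}=\phi^\Phi_j\circ\theta$ for all $j\in I^\Phi$; it respects $i$ if $\alpha(i)\ne*$, $\alpha(j)\ne\alpha(i)$ for $j\ne i$, $W^\Phi_i=W^{\Phi'}_{\alpha(i)}$ and $\sigma_i=\mathrm{id}$. $\Phi$ has Cauchy--Schwarz complexity at most $s$ at $i$ if $I^\Phi\setminus\{i\}$ can be partitioned into $s+1$ sets $S_1,\dots,S_{s+1}$ such that for each $r$ there is a linear map $\mu_r\colon W_i\to V$ with $\phi_i\circ\mu_r=\mathrm{id}_{W_i}$ and $\phi_j\circ\mu_r=0$ for all $j\in S_r$. For a finite-dimensional space $U$, the generalized convolution datum $\mathrm{gc}_s(U)$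 has $V=U^{s+1}$, index set $\{\triangle,1,\dots,s+1\}$, $W_\triangle=U$, $W_r=U^s$, $\phi_\triangle(x_1,\dots,x_{s+1})=x_1+\dots+x_{s+1}$ and $\phi_r$ the map omitting the $r$-th coordinate. -}

module Defs where

open import Data.Nat using (ℕ; zero; suc; _+_; _*_; NonZero)
open import Data.Nat.DivMod using (_mod_)
open import Data.Fin using (Fin; zero; suc; toℕ; remQuot; punchIn; _≟_)
open import Data.Maybe using (Maybe; just; nothing)
open import Data.Product using (Σ; _×_; _,_; proj₁; proj₂)
open import Data.Bool using (if_then_else_; _∧_)
open import Relation.Nullary using (¬_; does)
open import Relation.Binary.PropositionalEquality using (_≡_)

-- Finite-dimensional F_p-spaces are modelled as F_p^n (n = dimension), with
-- F_p = Fin p (arithmetic mod p); linear maps F_p^n → F_p^m are m×n matrices.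
Fp : ℕ → Set
Fp p = Fin p

Mat : ℕ → ℕ → ℕ → Set
Mat p m n = Fin m → Fin n → Fp p

sumℕ : {n : ℕ} → (Fin n → ℕ) → ℕ
sumℕ {zero} f = 0
sumℕ {suc n} f = f zero + sumℕ (λ j → f (suc j))

module _ (p : ℕ) .{{_ : NonZero p}} where

  zeroF : Fp p
  zeroF = 0 mod p

  oneF : Fp p
  oneF = 1 mod p

  δ : {n : ℕ} → Fin n → Fin n → Fp p
  δ a b = if does (a ≟ b) then oneF else zeroF

  _⊙_ : {l m n : ℕ} → Mat p l m → Mat p m n → Mat p l n
  (A ⊙ B) r c = sumℕ (λ j → toℕ (A r j) * toℕ (B j c)) mod p

  zeroMat : {m n : ℕ} → Mat p m n
  zeroMat _ _ = zeroF

_≈M_ : {p m n : ℕ} → Mat p m n → Mat p m n → Set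
A ≈M B = ∀ r c → A r c ≡ B r c

IsId : (p : ℕ) .{{_ : NonZero p}} {m n : ℕ} → Mat p m n → Set
IsId p {m} {n} A = Σ (m ≡ n) λ _ → ∀ r c → A r c ≡
  (if does (toℕ r Data.Nat.≟ toℕ c) then oneF p else zeroF p)

record LinearDatum (p : ℕ) : Set where
  field
    idx  : ℕ
    dimV : ℕ
    dimW : Fin idx → ℕ
    φ    : (i : Fin idx) → Mat p (dimW i) dimV
open LinearDatum public

-- the extended index set I ∪ {*}, with * = nothing, W_* = 0, φ_* = 0
dimW* : {p : ℕ} (Φ : LinearDatum p) → Maybe (Fin (idx Φ)) → ℕ
dimW* Φ (just i) = dimW Φ i
dimW* Φ nothing = 0

φ* : (p : ℕ) .{{_ : NonZero p}} (Φ : LinearDatum p) → (a : Maybe (Fin (idx Φ))) → Mat p (dimW* Φ a) (dimV Φ)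
φ* p Φ (just i) = φ Φ i
φ* p Φ nothing = zeroMat p

record Morphism (p : ℕ) .{{_ : NonZero p}} (Φ' Φ : LinearDatum p)
                (α : Fin (idx Φ) → Maybe (Fin (idx Φ'))) : Set where
  field
    θ    : Mat p (dimV Φ) (dimV Φ')
    σ    : (j : Fin (idx Φ)) → Mat p (dimW Φ j) (dimW* Φ' (α j))
    comm : (j : Fin (idx Φ)) → _⊙_ p (σ j) (φ* p Φ' (α j)) ≈M _⊙_ p (φ Φ j) θ
open Morphism public

Respects : (p : ℕ) .{{_ : NonZero p}} {Φ' Φ : LinearDatum p}
           {α : Fin (idx Φ) → Maybe (Fin (idx Φ'))} →
           Morphism p Φ' Φ α → Fin (idx Φ) → Set
Respects p {Φ'} {Φ} {α} Θ i =
  (¬ (α i ≡ nothing)) ×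
  ((j : Fin (idx Φ)) → ¬ (j ≡ i) → ¬ (α j ≡ α i)) ×
  (dimW Φ i ≡ dimW* Φ' (α i)) ×
  IsId p (σ Θ i)

-- Cauchy–Schwarz complexity at most s at i: a partition of I \ {i} into
-- s+1 (possibly empty) parts, given by the part-assignment `part`
HasCSComplexity : (p : ℕ) .{{_ : NonZero p}} (Φ : LinearDatum p) (s : ℕ) (i : Fin (idx Φ)) → Set
HasCSComplexity p Φ s i =
  Σ ((j : Fin (idx Φ)) → ¬ (j ≡ i) → Fin (suc s)) λ part →
  (r : Fin (suc s)) → Σ (Mat p (dimV Φ) (dimW Φ i)) λ μ →
    (IsId p (_⊙_ p (φ Φ i) μ)) ×
    ((j : Fin (idx Φ)) (h : ¬ (j ≡ i)) → part j h ≡ r → _⊙_ p (φ Φ j) μ ≈M zeroMat p)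

-- Index set Fin (s+2): zero = △, suc r = r (r ∈ Fin (s+1), i.e. 1..s+1).
-- V = U^{s+1} = F_p^{(s+1)*u}, coordinate index decoded by remQuot into (block, coordinate);
-- W_r = U^s = F_p^{s*u}, similarly decoded.
gcDimW : (s u : ℕ) → Fin (suc (suc s)) → ℕ
gcDimW s u zero = u
gcDimW s u (suc r) = s * u

gcφ : (p : ℕ) .{{_ : NonZero p}} (s u : ℕ) → (a : Fin (suc (suc s))) → Mat p (gcDimW s u a) (suc s * u)
-- φ_△(x_1,…,x_{s+1}) = x_1 + … + x_{s+1}
gcφ p s u zero c col = δ p c (proj₂ (remQuot {suc s} u col))
-- φ_r omits the r-th coordinate: output block t is input block punchIn r t
gcφ p s u (suc r) row col =
  let (t , c) = remQuot {s} u row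
      (b , d) = remQuot {suc s} u col
  in if does (b ≟ punchIn r t) ∧ does (c ≟ d) then oneF p else zeroF p

gc : (p : ℕ) .{{_ : NonZero p}} (s u : ℕ) → LinearDatum p
gc p s u = record { idx = suc (suc s) ; dimV = suc s * u ; dimW = gcDimW s u ; φ = gcφ p s u }

{-# OPTIONS --safe #-}
module Submission where

-- Write V = U^(s+1) as s+1 copies of U = W_i.  A morphism gc_s(U) → Φ respecting i
-- with α(i) = △ is a map θ : U^(s+1) → V; since σ_i = id, the restriction μ_r of θ to
-- the r-th copy is a section of φ_i, and φ_j ∘ θ factors through φ_{α(j)}, which kills
-- the (α(j))-th copy, so φ_j ∘ μ_{α(j)} = 0: the parts are S_r = α⁻¹(r).  Conversely,
-- given the sections μ_r, put θ = [μ_1 | … | μ_(s+1)], send j ∈ S_r to r, and let σ_j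
-- apply φ_j ∘ μ_t to the t-th coordinate for t ≠ r; this is φ_j ∘ θ on every copy
-- except the r-th one, where φ_j ∘ θ vanishes anyway.

open import Defs
open import Data.Bool using (if_then_else_)
open import Data.Empty using (⊥-elim)
open import Data.Fin using (Fin; zero; suc; toℕ; remQuot; combine; punchIn; punchOut; _≟_)
open import Data.Fin.Properties
  using (toℕ-injective; toℕ<n; toℕ-fromℕ<; suc-injective; remQuot-combine; combine-remQuot;
         punchInᵢ≢i; punchIn-punchOut; punchIn-injective)
open import Data.Maybe using (Maybe; just; nothing)
open import Data.Nat using (ℕ; zero; suc; _+_; _*_; _<_; _≤_; NonZero; z<s; nonTrivial⇒n>1)
  renaming (_≟_ to _≟ℕ_)
open import Data.Nat.DivMod using (_mod_; m<n⇒m%n≡m)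
open import Data.Nat.Primality using (Prime; prime⇒nonTrivial)
open import Data.Nat.Properties using (*-zeroʳ; *-identityʳ; +-identityʳ; <-trans)
open import Data.Product using (Σ; _×_; _,_; proj₁; proj₂)
open import Function using (_∘_)
open import Function.Bundles using (_⇔_; mk⇔)
open import Relation.Binary.PropositionalEquality
open import Relation.Nullary using (Dec; yes; no; does; ¬_)
open import Relation.Nullary.Decidable using (_×-dec_; dec-true; dec-false)

sumℕ-zero : ∀ {n} (f : Fin n → ℕ) → (∀ k → f k ≡ 0) → sumℕ f ≡ 0
sumℕ-zero {zero} f f≡0 = refl
sumℕ-zero {suc n} f f≡0 = cong₂ _+_ (f≡0 zero) (sumℕ-zero (f ∘ suc) (f≡0 ∘ suc))

sumℕ-single : ∀ {n} (f : Fin n → ℕ) (k₀ : Fin n) → (∀ k → k ≢ k₀ → f k ≡ 0) → sumℕ f ≡ f k₀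
sumℕ-single f zero f≡0 =
  trans (cong (f zero +_) (sumℕ-zero (f ∘ suc) (λ k → f≡0 (suc k) λ ()))) (+-identityʳ _)
sumℕ-single f (suc k₀) f≡0 =
  trans (cong (_+ sumℕ (f ∘ suc)) (f≡0 zero λ ()))
        (sumℕ-single (f ∘ suc) k₀ (λ k k≢k₀ → f≡0 (suc k) (k≢k₀ ∘ suc-injective)))

module Matrices (p : ℕ) .{{_ : NonZero p}} (p>1 : 1 < p) where

  toℕ-mod : (x : Fp p) → toℕ x mod p ≡ x
  toℕ-mod x = toℕ-injective (trans (toℕ-fromℕ< _) (m<n⇒m%n≡m (toℕ<n x)))

  toℕ-zeroF : toℕ (zeroF p) ≡ 0
  toℕ-zeroF = trans (toℕ-fromℕ< _) (m<n⇒m%n≡m (<-trans z<s p>1))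

  toℕ-oneF : toℕ (oneF p) ≡ 1
  toℕ-oneF = trans (toℕ-fromℕ< _) (m<n⇒m%n≡m p>1)

  indicator : {A : Set} → Dec A → Fp p
  indicator a? = if does a? then oneF p else zeroF p

  indicator-yes : {A : Set} (a? : Dec A) → A → indicator a? ≡ oneF p
  indicator-yes a? a rewrite dec-true a? a = refl

  indicator-no : {A : Set} (a? : Dec A) → ¬ A → indicator a? ≡ zeroF p
  indicator-no a? ¬a rewrite dec-false a? ¬a = refl

  idMat : ∀ {n} → Mat p n n
  idMat r c = indicator (toℕ r ≟ℕ toℕ c)

  ZeroColumn : ∀ {m n} → Mat p m n → Fin n → Set
  ZeroColumn B c = ∀ k → B k c ≡ zeroF p

  UnitColumn : ∀ {m n} → Mat p m n → Fin m → Fin n → Set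
  UnitColumn B k₀ c = B k₀ c ≡ oneF p × (∀ k → k ≢ k₀ → B k c ≡ zeroF p)

  ⊙-zeroColumn : ∀ {l m n} (A : Mat p l m) (B : Mat p m n) {c} → ZeroColumn B c →
                 ∀ r → _⊙_ p A B r c ≡ zeroF p
  ⊙-zeroColumn A B {c} B≡0 r = cong (_mod p) (sumℕ-zero _ term≡0)
    where
    term≡0 : ∀ k → toℕ (A r k) * toℕ (B k c) ≡ 0
    term≡0 k rewrite B≡0 k | toℕ-zeroF = *-zeroʳ (toℕ (A r k))

  ⊙-unitColumn : ∀ {l m n} (A : Mat p l m) (B : Mat p m n) {k₀ c} → UnitColumn B k₀ c →
                 ∀ r → _⊙_ p A B r c ≡ A r k₀
  ⊙-unitColumn A B {k₀} {c} (B≡1 , B≡0) r =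
    trans (cong (_mod p) (trans (sumℕ-single _ k₀ term≡0) pick)) (toℕ-mod (A r k₀))
    where
    term≡0 : ∀ k → k ≢ k₀ → toℕ (A r k) * toℕ (B k c) ≡ 0
    term≡0 k k≢k₀ rewrite B≡0 k k≢k₀ | toℕ-zeroF = *-zeroʳ (toℕ (A r k))
    pick : toℕ (A r k₀) * toℕ (B k₀ c) ≡ toℕ (A r k₀)
    pick rewrite B≡1 | toℕ-oneF = *-identityʳ (toℕ (A r k₀))

module Convolution (p : ℕ) .{{_ : NonZero p}} (p>1 : 1 < p) (s u : ℕ) where
  open Matrices p p>1

  block : ∀ {n} → Fin (n * u) → Fin n
  block {n} col = proj₁ (remQuot {n} u col)

  coord : ∀ {n} → Fin (n * u) → Fin u
  coord {n} col = proj₂ (remQuot {n} u col)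

  block-combine : ∀ {n} (b : Fin n) (d : Fin u) → block {n} (combine b d) ≡ b
  block-combine b d = cong proj₁ (remQuot-combine b d)

  coord-combine : ∀ {n} (b : Fin n) (d : Fin u) → coord {n} (combine b d) ≡ d
  coord-combine b d = cong proj₂ (remQuot-combine b d)

  △-unitColumn : ∀ col → UnitColumn (gcφ p s u zero) (coord col) col
  △-unitColumn col = indicator-yes (coord col ≟ coord col) refl
                   , λ k k≢d → indicator-no (k ≟ coord col) k≢d

  omitted-zeroColumn : ∀ r col → block col ≡ r → ZeroColumn (gcφ p s u (suc r)) col
  omitted-zeroColumn r col b≡r k =
    indicator-no ((block col ≟ punchIn r (block {s} k)) ×-dec (coord {s} k ≟ coord col))
                 (λ (b≡ , _) → punchInᵢ≢i r (block k) (trans (sym b≡) b≡r))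

  kept-unitColumn : ∀ r col (r≢b : r ≢ block col) →
                    UnitColumn (gcφ p s u (suc r)) (combine (punchOut r≢b) (coord col)) col
  kept-unitColumn r col r≢b =
    indicator-yes ((block col ≟ punchIn r (block {s} k₀)) ×-dec (coord {s} k₀ ≟ coord col))
                  ( trans (sym (punchIn-punchOut r≢b)) (cong (punchIn r) (sym (block-combine t d)))
                  , coord-combine t d )
    , λ k k≢k₀ →
        indicator-no ((block col ≟ punchIn r (block {s} k)) ×-dec (coord {s} k ≟ coord col))
          (λ (b≡ , c≡d) → k≢k₀ (begin
             k                                   ≡⟨ combine-remQuot {s} u k ⟨
             combine (block {s} k) (coord {s} k) ≡⟨ cong₂ combine (block≡t k b≡) c≡d ⟩
             k₀                                  ∎))
    where
    open ≡-Reasoning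
    t = punchOut r≢b
    d = coord col
    k₀ = combine t d
    block≡t : ∀ k → block col ≡ punchIn r (block {s} k) → block {s} k ≡ t
    block≡t k b≡ = punchIn-injective r (block k) t (trans (sym b≡) (sym (punchIn-punchOut r≢b)))

module _ (p : ℕ) .{{_ : NonZero p}} (p>1 : 1 < p) (Φ : LinearDatum p) (i : Fin (idx Φ)) (s : ℕ) where
  open Matrices p p>1
  open Convolution p p>1 s (dimW Φ i)
  open ≡-Reasoning

  private
    u : ℕ
    u = dimW Φ i

    G : LinearDatum p
    G = gc p s u

    Index : Set
    Index = Maybe (Fin (idx G))

  RespectingGcMorphism : Set
  RespectingGcMorphism =
    Σ (Fin (idx Φ) → Index) λ α → (α i ≡ just zero) × Σ (Morphism p G Φ α) λ Θ → Respects p Θ i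

  restrict : Mat p (dimV Φ) (suc s * u) → Fin (suc s) → Mat p (dimV Φ) u
  restrict θ′ r row d = θ′ row (combine r d)

  -- φ_* = 0 kills every copy, so for * the choice of copy is arbitrary.
  blockOf : Index → Fin (suc s)
  blockOf nothing        = zero
  blockOf (just zero)    = zero
  blockOf (just (suc r)) = r

  φ*-blockOf-zeroColumn : ∀ a → a ≢ just zero → ∀ d → ZeroColumn (φ* p G a) (combine (blockOf a) d)
  φ*-blockOf-zeroColumn nothing        _    d ()
  φ*-blockOf-zeroColumn (just zero)    a≢△  = ⊥-elim (a≢△ refl)
  φ*-blockOf-zeroColumn (just (suc r)) _    d = omitted-zeroColumn r (combine r d) (block-combine r d)

  restrict-section : ∀ a → a ≡ just zero → (σᵢ : Mat p u (dimW* G a)) → IsId p σᵢ →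
                     (θ′ : Mat p (dimV Φ) (suc s * u)) → _⊙_ p σᵢ (φ* p G a) ≈M _⊙_ p (φ Φ i) θ′ →
                     ∀ r → IsId p (_⊙_ p (φ Φ i) (restrict θ′ r))
  restrict-section .(just zero) refl σᵢ (_ , σᵢ≡id) θ′ comm′ r = refl , λ row d → begin
    _⊙_ p (φ Φ i) θ′ row (combine r d)
      ≡⟨ comm′ row (combine r d) ⟨
    _⊙_ p σᵢ (gcφ p s u zero) row (combine r d)
      ≡⟨ ⊙-unitColumn σᵢ (gcφ p s u zero) (△-unitColumn (combine r d)) row ⟩
    σᵢ row (coord (combine r d))
      ≡⟨ cong (σᵢ row) (coord-combine r d) ⟩
    σᵢ row d
      ≡⟨ σᵢ≡id row d ⟩
    idMat row d ∎

  restrict-vanishes : ∀ j a → a ≢ just zero → (σⱼ : Mat p (dimW Φ j) (dimW* G a)) →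
                      (θ′ : Mat p (dimV Φ) (suc s * u)) → _⊙_ p σⱼ (φ* p G a) ≈M _⊙_ p (φ Φ j) θ′ →
                      _⊙_ p (φ Φ j) (restrict θ′ (blockOf a)) ≈M zeroMat p
  restrict-vanishes j a a≢△ σⱼ θ′ comm′ row d =
    trans (sym (comm′ row (combine (blockOf a) d)))
          (⊙-zeroColumn σⱼ (φ* p G a) (φ*-blockOf-zeroColumn a a≢△ d) row)

  morphism⇒csComplexity : RespectingGcMorphism → HasCSComplexity p Φ s i
  morphism⇒csComplexity (α , αᵢ≡△ , Θ , _ , α-separates , _ , σᵢ-id) =
    (λ j _ → blockOf (α j)) ,
    λ r → restrict (θ Θ) r
        , restrict-section (α i) αᵢ≡△ (σ Θ i) σᵢ-id (θ Θ) (comm Θ i) r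
        , λ j j≢i blockOf≡r →
            subst (λ r → _⊙_ p (φ Φ j) (restrict (θ Θ) r) ≈M zeroMat p) blockOf≡r
              (restrict-vanishes j (α j) (λ αⱼ≡△ → α-separates j j≢i (trans αⱼ≡△ (sym αᵢ≡△)))
                                 (σ Θ j) (θ Θ) (comm Θ j))

  module FromSections
    (part : (j : Fin (idx Φ)) → j ≢ i → Fin (suc s))
    (μ : Fin (suc s) → Mat p (dimV Φ) u)
    (μ-section : ∀ r → IsId p (_⊙_ p (φ Φ i) (μ r)))
    (μ-vanishes : ∀ j (j≢i : j ≢ i) → _⊙_ p (φ Φ j) (μ (part j j≢i)) ≈M zeroMat p)
    where

    θμ : Mat p (dimV Φ) (suc s * u)
    θμ row col = μ (block col) row (coord {suc s} col)

    shape : ∀ j → Dec (j ≡ i) → Index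
    shape j (yes _)  = just zero
    shape j (no j≢i) = just (suc (part j j≢i))

    σμ : ∀ j (d : Dec (j ≡ i)) → Mat p (dimW Φ j) (dimW* G (shape j d))
    σμ .i (yes refl) = idMat
    σμ j (no j≢i) row col = _⊙_ p (φ Φ j) (μ (punchIn (part j j≢i) (block {s} col))) row (coord {s} col)

    σμ-commutes : ∀ j (d : Dec (j ≡ i)) → _⊙_ p (σμ j d) (φ* p G (shape j d)) ≈M _⊙_ p (φ Φ j) θμ
    σμ-commutes .i (yes refl) row col = begin
      _⊙_ p idMat (gcφ p s u zero) row col
        ≡⟨ ⊙-unitColumn idMat (gcφ p s u zero) (△-unitColumn col) row ⟩
      idMat row (coord col)
        ≡⟨ proj₂ (μ-section (block col)) row (coord col) ⟨
      _⊙_ p (φ Φ i) (μ (block col)) row (coord col) ∎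
    σμ-commutes j (no j≢i) row col with block col ≟ part j j≢i
    ... | yes b≡r = begin
      _⊙_ p (σμ j (no j≢i)) (gcφ p s u (suc r)) row col
        ≡⟨ ⊙-zeroColumn (σμ j (no j≢i)) (gcφ p s u (suc r)) (omitted-zeroColumn r col b≡r) row ⟩
      zeroF p
        ≡⟨ μ-vanishes j j≢i row (coord col) ⟨
      _⊙_ p (φ Φ j) (μ r) row (coord col)
        ≡⟨ cong (λ b → _⊙_ p (φ Φ j) (μ b) row (coord col)) b≡r ⟨
      _⊙_ p (φ Φ j) (μ (block col)) row (coord col) ∎
      where r = part j j≢i
    ... | no b≢r = begin
      _⊙_ p (σμ j (no j≢i)) (gcφ p s u (suc r)) row col
        ≡⟨ ⊙-unitColumn (σμ j (no j≢i)) (gcφ p s u (suc r)) (kept-unitColumn r col r≢b) row ⟩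
      _⊙_ p (φ Φ j) (μ (punchIn r (block {s} (combine t d)))) row (coord {s} (combine t d))
        ≡⟨ cong₂ (λ b e → _⊙_ p (φ Φ j) (μ b) row e)
                 (trans (cong (punchIn r) (block-combine t d)) (punchIn-punchOut r≢b))
                 (coord-combine t d) ⟩
      _⊙_ p (φ Φ j) (μ (block col)) row (coord col) ∎
      where
      r = part j j≢i
      r≢b = b≢r ∘ sym
      t = punchOut r≢b
      d = coord col

    shape-defined : ∀ j (d : Dec (j ≡ i)) → shape j d ≢ nothing
    shape-defined j (yes _) ()
    shape-defined j (no _)  ()

    shape-at-i : (d : Dec (i ≡ i)) → shape i d ≡ just zero
    shape-at-i (yes _)   = refl
    shape-at-i (no i≢i) = ⊥-elim (i≢i refl)

    shape-off-i : ∀ j → j ≢ i → (d : Dec (j ≡ i)) → shape j d ≢ just zero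
    shape-off-i j j≢i (yes j≡i) = ⊥-elim (j≢i j≡i)
    shape-off-i j _   (no _)    ()

    σμ-at-i : (d : Dec (i ≡ i)) → IsId p (σμ i d)
    σμ-at-i (yes refl) = refl , λ _ _ → refl
    σμ-at-i (no i≢i)  = ⊥-elim (i≢i refl)

    morphism : RespectingGcMorphism
    morphism =
      α , shape-at-i (i ≟ i) ,
      record { θ = θμ ; σ = λ j → σμ j (j ≟ i) ; comm = λ j → σμ-commutes j (j ≟ i) } ,
      shape-defined i (i ≟ i) ,
      (λ j j≢i αⱼ≡αᵢ → shape-off-i j j≢i (j ≟ i) (trans αⱼ≡αᵢ (shape-at-i (i ≟ i)))) ,
      cong (dimW* G) (sym (shape-at-i (i ≟ i))) ,
      σμ-at-i (i ≟ i)
      where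
      α : Fin (idx Φ) → Index
      α j = shape j (j ≟ i)

  csComplexity⇒morphism : HasCSComplexity p Φ s i → RespectingGcMorphism
  csComplexity⇒morphism (part , sections) =
    FromSections.morphism part (proj₁ ∘ sections) (proj₁ ∘ proj₂ ∘ sections)
                          (λ j j≢i → proj₂ (proj₂ (sections (part j j≢i))) j j≢i refl)

-- Primality enters only through p > 1, and the equivalence holds for every s, s = 0 included.
lemma3p5 : (p : ℕ) .{{_ : NonZero p}} → Prime p →
    (Φ : LinearDatum p) (i : Fin (idx Φ)) (s : ℕ) → 1 ≤ s →
    HasCSComplexity p Φ s i ⇔
      Σ (Fin (idx Φ) → Maybe (Fin (idx (gc p s (dimW Φ i))))) λ α →
        (α i ≡ just zero) ×
        Σ (Morphism p (gc p s (dimW Φ i)) Φ α) λ Θ → Respects p Θ i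
lemma3p5 p p-prime Φ i s _ =
  mk⇔ (csComplexity⇒morphism p p>1 Φ i s) (morphism⇒csComplexity p p>1 Φ i s)
  where
  p>1 : 1 < p
  p>1 = nonTrivial⇒n>1 p {{prime⇒nonTrivial p-prime}}
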